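{- Let $\mathcal{K}$ be a class of closed transformation monoids and $\mathcal{G}=\{G(N)\mid N\in\mathcal{K}\}$, where $G(N)$ is the group of invertible elements of $N$. Assume $\overline{H}\in\mathcal{K}$ for every $H\in\mathcal{G}$, where $\overline{H}$ is the closure of $H$ in the full transformation monoid on its carrier. Let $M\subseteq A^A$ be a closed transformation monoid with automatic homeomorphicity with respect to $\mathcal{K}$, whose group $G=G(M)$ of invertibles is dense in $M$. If $G$ has automatic action compatibility with respect to $\mathcal{G}$, then $M$ has automatic action compatibility with respect to $\mathcal{K}$.
   Context: $A^A$ carries the topology of pointwise convergence ($A$ discrete). For a permutation group / transformation monoid $F$ on $A$ and a class $\mathcal{L}$ of permutation groups / transformation monoids: $F$ has automatic homeomorphicity w.r.t. $\mathcal{L}$ if for every $F'\in\mathcal{L}$ on a set $B$ with $|B|=|A|$ every group / monoid isomorphism $F\to F'$ is a homeomorphism; $F$ has automatic action compatibility w.r.t. $\mathcal{L}$ if for every such $F'$ and every group / monoid isomorphism $\phi\colon F\to F'$ there is a bijection $\theta\colon A\to B$ with $\phi(f)=\theta\circ f\circ\theta^{ -1}$ for all $f\in F$. -}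

module Defs where

open import Level using (Level; suc; zero)
open import Data.List using (List)
open import Data.List.Relation.Unary.All using (All)
open import Data.Product using (Σ; ∃; _×_; _,_; proj₁; proj₂)
open import Function using (_∘_; id; _↔_)
open import Function.Bundles using (Inverse)
open import Relation.Binary.PropositionalEquality using (_≡_; _≗_)

Sub : Set → Set₁
Sub A = (A → A) → Set

Elt : {A : Set} → Sub A → Set
Elt {A} P = Σ (A → A) P

AgreeOn : {A : Set} → List A → (A → A) → (A → A) → Set
AgreeOn F f g = All (λ a → f a ≡ g a) F

record IsTransMonoid {A : Set} (M : Sub A) : Set where
  field
    resp  : ∀ {f g} → f ≗ g → M f → M g
    hasId : M id
    comp  : ∀ {f g} → M f → M g → M (f ∘ g)

-- Closure of a subset in A^A w.r.t. the topology of pointwise convergence (A discrete):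
-- f is in the closure iff every basic neighbourhood of f (given by a finite set) meets S.
Closure : {A : Set} → Sub A → Sub A
Closure S f = ∀ (F : List _) → Σ (_ → _) λ g → S g × AgreeOn F f g

IsClosed : {A : Set} → Sub A → Set
IsClosed S = ∀ f → Closure S f → S f

IsClosedTransMonoid : {A : Set} → Sub A → Set
IsClosedTransMonoid M = IsTransMonoid M × IsClosed M

-- S is dense in M (S ⊆ M assumed separately): M ⊆ closure of S.
DenseIn : {A : Set} → Sub A → Sub A → Set
DenseIn S M = ∀ f → M f → Closure S f

Units : {A : Set} → Sub A → Sub A
Units M f = M f × Σ (_ → _) λ g → M g × (f ∘ g ≗ id) × (g ∘ f ≗ id)

SameSub : {A : Set} → Sub A → Sub A → Set
SameSub P Q = (∀ f → P f → Q f) × (∀ f → Q f → P f)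

Class : Set₂
Class = (B : Set) → Sub B → Set₁

UnitsClass : Class → Class
UnitsClass K B H = Σ (Sub B) λ N → K B N × SameSub H (Units N)

-- Isomorphism of transformation monoids (resp. groups), elements compared pointwise.
record Iso {A B : Set} (P : Sub A) (Q : Sub B) : Set where
  field
    to      : Elt P → Elt Q
    from    : Elt Q → Elt P
    to-cong   : ∀ x y → proj₁ x ≗ proj₁ y → proj₁ (to x) ≗ proj₁ (to y)
    from-cong : ∀ x y → proj₁ x ≗ proj₁ y → proj₁ (from x) ≗ proj₁ (from y)
    to-hom  : ∀ f g (pf : P f) (pg : P g) (pfg : P (f ∘ g)) →
              proj₁ (to (f ∘ g , pfg)) ≗ proj₁ (to (f , pf)) ∘ proj₁ (to (g , pg))
    to-id   : ∀ (p : P id) → proj₁ (to (id , p)) ≗ id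
    from-to : ∀ x → proj₁ (from (to x)) ≗ proj₁ x
    to-from : ∀ y → proj₁ (to (from y)) ≗ proj₁ y

Continuous : {A B : Set} {P : Sub A} {Q : Sub B} → (Elt P → Elt Q) → Set
Continuous {A} {B} {P} ψ =
  ∀ (x : Elt P) (F : List B) → Σ (List A) λ E →
    ∀ (y : Elt P) → AgreeOn E (proj₁ x) (proj₁ y) →
      AgreeOn F (proj₁ (ψ x)) (proj₁ (ψ y))

IsHomeomorphism : {A B : Set} {P : Sub A} {Q : Sub B} → Iso P Q → Set
IsHomeomorphism φ = Continuous (Iso.to φ) × Continuous (Iso.from φ)

AutoHomeo : (L : Class) → {A : Set} → Sub A → Set₁
AutoHomeo L {A} F =
  ∀ (B : Set) → B ↔ A → ∀ (F' : Sub B) → L B F' →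
    ∀ (φ : Iso F F') → IsHomeomorphism φ

AutoActionCompat : (L : Class) → {A : Set} → Sub A → Set₁
AutoActionCompat L {A} F =
  ∀ (B : Set) → B ↔ A → ∀ (F' : Sub B) → L B F' →
    ∀ (φ : Iso F F') → Σ (A ↔ B) λ θ →
      ∀ (x : Elt F) →
        proj₁ (Iso.to φ x) ≗ Inverse.to θ ∘ proj₁ x ∘ Inverse.from θ

module Submission where

-- Let φ : M ≅ M' be a monoid isomorphism onto a
-- member M' of 𝒦.  Isomorphisms preserve inverse pairs, so φ restricts to an
-- isomorphism ψ : G(M) ≅ G(M') of the unit groups; G(M') belongs to 𝒢, hence
-- automatic action compatibility of G(M) yields a bijection θ : A ↔ B such that
-- ψ, i.e. φ on G(M), is conjugation by θ.  Automatic homeomorphicity makes φ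
-- continuous, conjugation by θ is continuous as well, and two continuous maps
-- agreeing on the dense subset G(M) agree on all of M.

open import Defs
open import Data.Product using (_,_; proj₁; proj₂)
open import Data.List using (_∷_; [])
open import Data.List.Relation.Unary.All using (_∷_; [])
open import Function using (_∘_; id; _↔_)
open import Function.Bundles using (Inverse)
open import Relation.Binary.PropositionalEquality
  using (_≗_; sym; trans; cong)
open Relation.Binary.PropositionalEquality.≡-Reasoning

conj : {A B : Set} → A ↔ B → (A → A) → (B → B)
conj θ f = Inverse.to θ ∘ f ∘ Inverse.from θ

module IsoProperties {A B : Set} {P : Sub A} {Q : Sub B}
                     (tmP : IsTransMonoid P) (φ : Iso P Q) where
  open Iso φ
  open IsTransMonoid tmP

  to-injective : ∀ x y → proj₁ (to x) ≗ proj₁ (to y) → proj₁ x ≗ proj₁ y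
  to-injective x y e a = begin
    proj₁ x a               ≡⟨ sym (from-to x a) ⟩
    proj₁ (from (to x)) a   ≡⟨ from-cong (to x) (to y) e a ⟩
    proj₁ (from (to y)) a   ≡⟨ from-to y a ⟩
    proj₁ y a               ∎

  inverse : Iso Q P
  inverse = record
    { to        = from
    ; from      = to
    ; to-cong   = from-cong
    ; from-cong = to-cong
    ; to-hom    = from-hom
    ; to-id     = from-id
    ; from-to   = to-from
    ; to-from   = from-to
    }
    where
    from-hom : ∀ f g (qf : Q f) (qg : Q g) (qfg : Q (f ∘ g)) →
               proj₁ (from (f ∘ g , qfg)) ≗ proj₁ (from (f , qf)) ∘ proj₁ (from (g , qg))
    from-hom f g qf qg qfg =
      to-injective (from (f ∘ g , qfg)) (u ∘ v , puv) λ b → begin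
        proj₁ (to (from (f ∘ g , qfg))) b       ≡⟨ to-from (f ∘ g , qfg) b ⟩
        f (g b)                                 ≡⟨ cong f (sym (to-from (g , qg) b)) ⟩
        f (proj₁ (to (from (g , qg))) b)        ≡⟨ sym (to-from (f , qf) _) ⟩
        proj₁ (to (from (f , qf))) (proj₁ (to (from (g , qg))) b)
                                                ≡⟨ sym (to-hom u v _ _ puv b) ⟩
        proj₁ (to (u ∘ v , puv)) b              ∎
      where
      u = proj₁ (from (f , qf))
      v = proj₁ (from (g , qg))
      puv = comp (proj₂ (from (f , qf))) (proj₂ (from (g , qg)))

    from-id : (q : Q id) → proj₁ (from (id , q)) ≗ id
    from-id q = to-injective (from (id , q)) (id , hasId) λ b →
      trans (to-from (id , q) b) (sym (to-id hasId b))

  to-inverse-pair : ∀ f g (pf : P f) (pg : P g) → f ∘ g ≗ id →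
                    proj₁ (to (f , pf)) ∘ proj₁ (to (g , pg)) ≗ id
  to-inverse-pair f g pf pg fg b = begin
    proj₁ (to (f , pf)) (proj₁ (to (g , pg)) b)   ≡⟨ sym (to-hom f g pf pg pfg b) ⟩
    proj₁ (to (f ∘ g , pfg)) b                    ≡⟨ to-cong _ (id , hasId) fg b ⟩
    proj₁ (to (id , hasId)) b                     ≡⟨ to-id hasId b ⟩
    b                                             ∎
    where pfg = comp pf pg

  to-units : Elt (Units P) → Elt (Units Q)
  to-units (f , pf , g , pg , fg , gf) =
    proj₁ (to (f , pf)) , proj₂ (to (f , pf)) , proj₁ (to (g , pg)) , proj₂ (to (g , pg)) ,
    to-inverse-pair f g pf pg fg , to-inverse-pair g f pg pf gf

restrict-to-units : {A B : Set} {P : Sub A} {Q : Sub B} →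
  IsTransMonoid P → IsTransMonoid Q → Iso P Q → Iso (Units P) (Units Q)
restrict-to-units tmP tmQ φ = record
  { to        = IsoProperties.to-units tmP φ
  ; from      = IsoProperties.to-units tmQ (IsoProperties.inverse tmP φ)
  ; to-cong   = λ { (f , pf) (g , pg) → to-cong (f , proj₁ pf) (g , proj₁ pg) }
  ; from-cong = λ { (f , pf) (g , pg) → from-cong (f , proj₁ pf) (g , proj₁ pg) }
  ; to-hom    = λ f g pf pg pfg → to-hom f g (proj₁ pf) (proj₁ pg) (proj₁ pfg)
  ; to-id     = λ p → to-id (proj₁ p)
  ; from-to   = λ { (f , pf) → from-to (f , proj₁ pf) }
  ; to-from   = λ { (f , pf) → to-from (f , proj₁ pf) }
  }
  where open Iso φ

-- A continuous map which agrees with conjugation by θ on a dense subset S of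
-- its domain agrees with conjugation by θ everywhere.  (Pointwise: to evaluate
-- at b, choose g ∈ S agreeing with f at θ⁻¹ b and on the finite set that
-- continuity demands for the output at b.)
dense-agreement : {A B : Set} {P : Sub A} {Q : Sub B} (ψ : Elt P → Elt Q) →
  Continuous ψ → (S : Sub A) (S⊆P : ∀ g → S g → P g) → DenseIn S P →
  (θ : A ↔ B) → (∀ g (sg : S g) → proj₁ (ψ (g , S⊆P g sg)) ≗ conj θ g) →
  ∀ (x : Elt P) → proj₁ (ψ x) ≗ conj θ (proj₁ x)
dense-agreement ψ cont S S⊆P dense θ onS (f , pf) b
  with cont (f , pf) (b ∷ [])
... | E , preserves with dense f pf (Inverse.from θ b ∷ E)
... | g , sg , (g≡f-at-θ⁻¹b ∷ g≡f-on-E) with preserves (g , S⊆P g sg) g≡f-on-E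
... | (ψf≡ψg-at-b ∷ []) = begin
  proj₁ (ψ (f , pf)) b              ≡⟨ ψf≡ψg-at-b ⟩
  proj₁ (ψ (g , S⊆P g sg)) b        ≡⟨ onS g sg b ⟩
  conj θ g b                        ≡⟨ cong (Inverse.to θ) (sym g≡f-at-θ⁻¹b) ⟩
  conj θ f b                        ∎

corollary4p2 : (K : Class) →
    (∀ B N → K B N → IsClosedTransMonoid N) →
    (∀ B H → UnitsClass K B H → K B (Closure H)) →
    (A : Set) → (M : Sub A) → IsClosedTransMonoid M →
    AutoHomeo K M →
    DenseIn (Units M) M →
    AutoActionCompat (UnitsClass K) (Units M) →
    AutoActionCompat K M
corollary4p2 K K-closed _ A M (tmM , _) homeo dense compat B B↔A M' M'∈K φ =
  θ , dense-agreement (Iso.to φ) φ-continuous (Units M) (λ _ → proj₁) dense θ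
        (λ g ug → ψ-is-conj (g , ug))
  where
  ψ : Iso (Units M) (Units M')
  ψ = restrict-to-units tmM (proj₁ (K-closed B M' M'∈K)) φ

  G'∈𝒢 : UnitsClass K B (Units M')
  G'∈𝒢 = M' , M'∈K , (λ _ p → p) , (λ _ p → p)

  θ : A ↔ B
  θ = proj₁ (compat B B↔A (Units M') G'∈𝒢 ψ)

  ψ-is-conj : ∀ (x : Elt (Units M)) → proj₁ (Iso.to ψ x) ≗ conj θ (proj₁ x)
  ψ-is-conj = proj₂ (compat B B↔A (Units M') G'∈𝒢 ψ)

  φ-continuous : Continuous (Iso.to φ)
  φ-continuous = proj₁ (homeo B B↔A M' M'∈K φ)
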